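{- The lower bound $\operatorname{bdim}(G)=\Omega(\log(\operatorname{adim}(G)))$ (valid for all graphs $G$) is asymptotically optimal: there is a family of graphs $G$ with $\operatorname{adim}(G)\to\infty$ and $\operatorname{bdim}(G)=O(\log(\operatorname{adim}(G)))$.
   Context: All graphs are finite, simple and undirected. $d(u,v)$ denotes graph distance ($\infty$ between different components), and for a positive integer $k$, $d_k(u,v)=\min\{d(u,v),k+1\}$. A function $f:V(G)\to\mathbb{Z}_{\ge0}$ is a resolving broadcast of $G$ if for any distinct $x,y\in V(G)$ there is $z$ with $f(z)>0$ and $d_{f(z)}(x,z)\ne d_{f(z)}(y,z)$; $\operatorname{bdim}(G)$ is the minimum of $\sum_v f(v)$ over resolving broadcasts $f$. A set $A\subseteq V(G)$ is an adjacency resolving set if for any distinct $x,y\in V(G)$ there is $z\in A$ with $d_1(x,z)\ne d_1(y,z)$; $\operatorname{adim}(G)$ is the minimum size of an adjacency resolving set. -}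

module Defs where

open import Data.Nat using (ℕ; zero; suc; _≤_; _<_)
open import Data.Bool using (Bool; true; false)
open import Data.Fin using (Fin)
open import Data.Fin.Subset using (Subset; _∈_; ∣_∣)
open import Data.List using (map; allFin)
open import Data.Nat.ListAction using (sum)
open import Data.Product using (Σ; ∃; _×_; _,_)
open import Data.Sum using (_⊎_)
open import Relation.Binary.PropositionalEquality using (_≡_; _≢_)
open import Relation.Nullary using (¬_)

record Graph : Set where
  field
    n      : ℕ
    adj    : Fin n → Fin n → Bool
    sym    : ∀ i j → adj i j ≡ adj j i
    irrefl : ∀ i → adj i i ≡ false
open Graph public

data Walk (G : Graph) : Fin (n G) → Fin (n G) → ℕ → Set where
  here : ∀ {x} → Walk G x x zero
  step : ∀ {x z y ℓ} → adj G x z ≡ true → Walk G z y ℓ → Walk G x y (suc ℓ)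

-- d(x,y) = d  (graph distance; no such d exists if x,y are in different components)
Dist : (G : Graph) → Fin (n G) → Fin (n G) → ℕ → Set
Dist G x y d = Walk G x y d × (∀ ℓ → ℓ < d → ¬ Walk G x y ℓ)

-- d_k(x,y) = j, where d_k(x,y) = min{d(x,y), k+1} (with d = ∞ across components)
TDist : (G : Graph) → ℕ → Fin (n G) → Fin (n G) → ℕ → Set
TDist G k x y j =
  (j ≤ k × Dist G x y j) ⊎ (j ≡ suc k × (∀ ℓ → ℓ ≤ k → ¬ Walk G x y ℓ))

Separates : (G : Graph) → ℕ → Fin (n G) → Fin (n G) → Fin (n G) → Set
Separates G k z x y =
  Σ ℕ λ j₁ → Σ ℕ λ j₂ → TDist G k x z j₁ × TDist G k y z j₂ × j₁ ≢ j₂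

IsResolvingBroadcast : (G : Graph) → (Fin (n G) → ℕ) → Set
IsResolvingBroadcast G f =
  ∀ x y → x ≢ y → Σ (Fin (n G)) λ z → (0 < f z) × Separates G (f z) z x y

cost : (G : Graph) → (Fin (n G) → ℕ) → ℕ
cost G f = sum (map f (allFin (n G)))

IsBdim : Graph → ℕ → Set
IsBdim G b =
  (Σ (Fin (n G) → ℕ) λ f → IsResolvingBroadcast G f × cost G f ≡ b)
  × (∀ f → IsResolvingBroadcast G f → b ≤ cost G f)

IsAdjResolving : (G : Graph) → Subset (n G) → Set
IsAdjResolving G A =
  ∀ x y → x ≢ y → Σ (Fin (n G)) λ z → (z ∈ A) × Separates G 1 z x y

IsAdim : Graph → ℕ → Set
IsAdim G a =
  (Σ (Subset (n G)) λ A → IsAdjResolving G A × ∣ A ∣ ≡ a)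
  × (∀ A → IsAdjResolving G A → a ≤ ∣ A ∣)

module Submission where

-- For k : ℕ let H k be the graph with k+1 landmarks z₀,…,z_k and, for each
-- j < 2^k, a hub p_j carrying a pendant leaf u_j.  The hub p_j is adjacent to
-- z₀, and to z_{i+1} exactly when binary digit i of j is 1.
--  * Upper bound: broadcasting strength 2 from every landmark resolves H k,
--    because the vector (d₂(v,z_i))_i determines v (values 0/2 on landmarks,
--    1/3 on hubs, 2/3 on leaves, chosen by the digits); so bdim ≤ 2(k+1).
--  * Lower bound: a leaf is at d₁-distance 2 from every vertex outside its own
--    pair {u_j,p_j}, so an adjacency resolving set meets the union of any two
--    pairs; it thus misses at most one pair and adim ≥ 2^k − 1.
-- The file first collects facts on truncated distances in arbitrary graphs,
-- then shows that adim and bdim exist for every graph (all notions involved are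
-- decidable, so a least-number principle applies), then builds H k and proves
-- both bounds.  The theorem follows with C = 6 and k = m + 2.

open import Defs hiding (sym)
open import Data.Nat
  using (ℕ; zero; suc; _+_; _*_; _^_; _≤_; _<_; z≤n; s≤s; s≤s⁻¹; _≤?_; _<?_)
open import Data.Nat.Properties
  using (≤-refl; ≤-trans; ≤-antisym; ≤-reflexive; <⇒≤; ≮⇒≥; n≤1+n; m≤m+n; m≤n+m;
         +-comm; +-suc; +-mono-≤; +-monoʳ-≤; *-monoʳ-≤; *-comm; *-zeroʳ; +-identityʳ;
         +-assoc; m≤n⇒m≤1+n; m^n>0; anyUpTo?; allUpTo?; <-cmp; module ≤-Reasoning)
  renaming (_≟_ to _≟ℕ_)
open import Relation.Binary using (tri<; tri≈; tri>)
open import Data.Nat.Induction using (<-rec)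
open import Data.Nat.Logarithm using (⌊log₂_⌋; ⌊log₂⌋-mono-≤; ⌊log₂[2^n]⌋≡n)
open import Data.Nat.ListAction using (sum)
open import Data.Bool using (Bool; true; false; if_then_else_)
open import Data.Bool.Properties using (not-¬) renaming (_≟_ to _≟ᵇ_)
open import Data.Fin
  using (Fin; zero; suc; toℕ; fromℕ<; _↑ˡ_; _↑ʳ_; splitAt; finToFun; funToFin; combine)
open import Data.Fin.Properties
  using (_≟_; any?; all?; ¬∀⟶∃¬; suc-injective; toℕ<n; toℕ-fromℕ<;
         splitAt-↑ˡ; splitAt-↑ʳ; splitAt⁻¹-↑ˡ; splitAt⁻¹-↑ʳ;
         funToFin-finToFin; finToFun-funToFin)
open import Data.Fin.Subset using (Subset; _∈_; ∣_∣; ⊤; _∪_)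
open import Data.Fin.Subset.Properties
  using (anySubset?; _∈?_; ∈⊤; drop-there; x∈p∪q⁺; ∣p∣≤∣x∷p∣; ∣⊤∣≡n; p⊆q⇒∣p∣≤∣q∣)
open import Data.Vec using ([]; _∷_; _++_; here; there)
import Data.Vec as Vec
open import Data.List using (allFin; tabulate)
open import Data.List.Properties using (map-tabulate; map-cong)
open import Data.Product using (Σ; _×_; _,_; proj₁; proj₂)
open import Data.Sum using (_⊎_; inj₁; inj₂; [_,_]′)
import Data.Sum as Sum
open import Data.Empty using (⊥-elim)
open import Function using (_∘_; id)
open import Relation.Binary.PropositionalEquality
  using (_≡_; _≢_; _≗_; refl; sym; trans; cong; cong₂; subst; module ≡-Reasoning)
open import Relation.Nullary using (¬_; Dec; yes; no; does; ¬?)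
open import Relation.Nullary.Decidable using (_×-dec_; _⊎-dec_; _→-dec_; map′; dec-true)

Adjacent : (G : Graph) → Fin (n G) → Fin (n G) → Set
Adjacent G x y = adj G x y ≡ true

-- Truncated distances in an arbitrary graph G.
module _ {G : Graph} where

  no-walk≤1 : ∀ {x y} → x ≢ y → ¬ Adjacent G x y → ∀ ℓ → ℓ ≤ 1 → ¬ Walk G x y ℓ
  no-walk≤1 x≢y _  zero          _               here          = x≢y refl
  no-walk≤1 _   ¬a (suc zero)    _               (step a here) = ¬a a
  no-walk≤1 _   _  (suc (suc _)) (s≤s ())

  no-walk≤2 : ∀ {x y} → x ≢ y → ¬ Adjacent G x y →
              (∀ w → Adjacent G x w → ¬ Adjacent G w y) → ∀ ℓ → ℓ ≤ 2 → ¬ Walk G x y ℓ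
  no-walk≤2 x≢y ¬a _ zero             _ = no-walk≤1 x≢y ¬a 0 z≤n
  no-walk≤2 x≢y ¬a _ (suc zero)       _ = no-walk≤1 x≢y ¬a 1 ≤-refl
  no-walk≤2 _ _ no-common (suc (suc zero)) _ (step a (step a′ here)) = no-common _ a a′
  no-walk≤2 _ _ _ (suc (suc (suc _))) (s≤s (s≤s ()))

  tdist-self : ∀ {k x} → TDist G k x x 0
  tdist-self = inj₁ (z≤n , here , λ _ ())

  tdist-adjacent : ∀ {k x y} → x ≢ y → Adjacent G x y → TDist G (suc k) x y 1
  tdist-adjacent x≢y a =
    inj₁ (s≤s z≤n , step a here , λ { zero _ here → x≢y refl ; (suc _) (s≤s ()) })

  tdist-common : ∀ {k x y w} → x ≢ y → ¬ Adjacent G x y →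
                 Adjacent G x w → Adjacent G w y → TDist G (suc (suc k)) x y 2
  tdist-common x≢y ¬a a a′ =
    inj₁ (s≤s (s≤s z≤n) , step a (step a′ here) , λ ℓ ℓ<2 → no-walk≤1 x≢y ¬a ℓ (s≤s⁻¹ ℓ<2))

  tdist-beyond₁ : ∀ {x y} → x ≢ y → ¬ Adjacent G x y → TDist G 1 x y 2
  tdist-beyond₁ x≢y ¬a = inj₂ (refl , no-walk≤1 x≢y ¬a)

  tdist-beyond₂ : ∀ {x y} → x ≢ y → ¬ Adjacent G x y →
                  (∀ w → Adjacent G x w → ¬ Adjacent G w y) → TDist G 2 x y 3
  tdist-beyond₂ x≢y ¬a no-common = inj₂ (refl , no-walk≤2 x≢y ¬a no-common)

  tdist-unique : ∀ {k x y j j′} → TDist G k x y j → TDist G k x y j′ → j ≡ j′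
  tdist-unique (inj₁ (_ , w , short)) (inj₁ (_ , w′ , short′)) with <-cmp _ _
  ... | tri< j<j′ _ _ = ⊥-elim (short′ _ j<j′ w)
  ... | tri≈ _ j≡j′ _ = j≡j′
  ... | tri> _ _ j>j′ = ⊥-elim (short _ j>j′ w′)
  tdist-unique (inj₁ (j≤k , w , _)) (inj₂ (_ , none)) = ⊥-elim (none _ j≤k w)
  tdist-unique (inj₂ (_ , none)) (inj₁ (j≤k , w , _)) = ⊥-elim (none _ j≤k w)
  tdist-unique (inj₂ (refl , _)) (inj₂ (refl , _)) = refl

  tdist-bound : ∀ {k x y j} → TDist G k x y j → j < suc (suc k)
  tdist-bound (inj₁ (j≤k , _)) = s≤s (m≤n⇒m≤1+n j≤k)
  tdist-bound (inj₂ (refl , _)) = ≤-refl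

  not-separating : ∀ {z x y} → TDist G 1 x z 2 → TDist G 1 y z 2 → ¬ Separates G 1 z x y
  not-separating dx dy (_ , _ , t₁ , t₂ , j₁≢j₂) =
    j₁≢j₂ (trans (tdist-unique t₁ dx) (sym (tdist-unique t₂ dy)))

  separates-self : ∀ {x y} → x ≢ y → Separates G 1 x x y
  separates-self {x} {y} x≢y with adj G y x in e
  ... | true  = 0 , 1 , tdist-self , tdist-adjacent (x≢y ∘ sym) e , λ ()
  ... | false = 0 , 2 , tdist-self , tdist-beyond₁ (x≢y ∘ sym) (not-¬ e) , λ ()

-- All notions of Defs are decidable: walks of a given length by recursion on
-- the length, distances by bounded search over shorter lengths, and the
-- separation predicates by bounded search over the (at most k+2) values of d_k.
module Decision (G : Graph) where

  walk? : ∀ x y ℓ → Dec (Walk G x y ℓ)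
  walk? x y zero with x ≟ y
  ... | yes refl = yes here
  ... | no x≢y   = no λ { here → x≢y refl }
  walk? x y (suc ℓ) with any? (λ w → (adj G x w ≟ᵇ true) ×-dec walk? w y ℓ)
  ... | yes (_ , a , walk) = yes (step a walk)
  ... | no none            = no λ { (step a walk) → none (_ , a , walk) }

  no-walk-below? : ∀ x y d → Dec (∀ ℓ → ℓ < d → ¬ Walk G x y ℓ)
  no-walk-below? x y d =
    map′ (λ h ℓ → h {ℓ}) (λ h {ℓ} → h ℓ) (allUpTo? (λ ℓ → ¬? (walk? x y ℓ)) d)

  tdist? : ∀ k x y j → Dec (TDist G k x y j)
  tdist? k x y j =
    ((j ≤? k) ×-dec walk? x y j ×-dec no-walk-below? x y j)
    ⊎-dec ((j ≟ℕ suc k) ×-dec map′ (λ h ℓ → h ℓ ∘ s≤s) (λ h ℓ → h ℓ ∘ s≤s⁻¹)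
                                   (no-walk-below? x y (suc k)))

  separates? : ∀ k z x y → Dec (Separates G k z x y)
  separates? k z x y =
    map′ (λ { (j₁ , _ , j₂ , _ , s) → j₁ , j₂ , s })
         (λ { (j₁ , j₂ , t₁ , t₂ , j₁≢j₂) →
                j₁ , tdist-bound t₁ , j₂ , tdist-bound t₂ , t₁ , t₂ , j₁≢j₂ })
         (anyUpTo? (λ j₁ → anyUpTo? (λ j₂ →
            tdist? k x z j₁ ×-dec tdist? k y z j₂ ×-dec ¬? (j₁ ≟ℕ j₂)) (2 + k)) (2 + k))

  resolving? : ∀ f → Dec (IsResolvingBroadcast G f)
  resolving? f = all? λ x → all? λ y → ¬? (x ≟ y) →-dec
                 any? λ z → (0 <? f z) ×-dec separates? (f z) z x y

  adj-resolving? : ∀ A → Dec (IsAdjResolving G A)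
  adj-resolving? A = all? λ x → all? λ y → ¬? (x ≟ y) →-dec
                     any? λ z → (z ∈? A) ×-dec separates? 1 z x y

Least : (ℕ → Set) → ℕ → Set
Least Q b = Q b × (∀ b′ → b′ < b → ¬ Q b′)

least : {Q : ℕ → Set} → (∀ b → Dec (Q b)) → ∀ w → Q w → Σ ℕ (Least Q)
least {Q} Q? = <-rec (λ w → Q w → Σ ℕ (Least Q)) search
  where
  search : ∀ w → (∀ {w′} → w′ < w → Q w′ → Σ ℕ (Least Q)) → Q w → Σ ℕ (Least Q)
  search w smaller q with anyUpTo? Q? w
  ... | yes (w′ , w′<w , q′) = smaller w′<w q′
  ... | no none              = w , q , λ b′ b′<w q′ → none (b′ , b′<w , q′)

Minimum : {X : Set} → (X → Set) → (X → ℕ) → ℕ → Set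
Minimum {X} R μ b = (Σ X λ x → R x × μ x ≡ b) × (∀ x → R x → b ≤ μ x)

minimum-exists : {X : Set} (R : X → Set) (μ : X → ℕ) →
                 (∀ b → Dec (Σ X λ x → R x × μ x ≤ b)) → Σ X R → Σ ℕ (Minimum R μ)
minimum-exists R μ bounded? (x₀ , r₀) with least bounded? (μ x₀) (x₀ , r₀ , ≤-refl)
... | b , (x , r , μx≤b) , below = b , (x , r , ≤-antisym μx≤b (optimal x r)) , optimal
  where
  optimal : ∀ y → R y → b ≤ μ y
  optimal y r = ≮⇒≥ λ μy<b → below (μ y) μy<b (y , r , ≤-refl)

-- Every graph has an adjacency dimension: the whole vertex set resolves.
adim-exists : (G : Graph) → Σ ℕ (IsAdim G)
adim-exists G =
  minimum-exists (IsAdjResolving G) ∣_∣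
    (λ b → anySubset? λ A → Decision.adj-resolving? G A ×-dec (∣ A ∣ ≤? b))
    (⊤ , λ x y x≢y → x , ∈⊤ , separates-self x≢y)

-- Search among the functions Fin m → ℕ bounded by b, which Fin ((1+b)^m)
-- enumerates; the predicate must be invariant under pointwise equality.
bounded-search : ∀ {m} b (Q : (Fin m → ℕ) → Set) → (∀ {f g} → f ≗ g → Q f → Q g) →
                 (∀ f → Dec (Q f)) → Dec (Σ (Fin m → ℕ) λ f → (∀ i → f i ≤ b) × Q f)
bounded-search {m} b Q respects Q? =
  map′ (λ (c , q) → decode c , (λ i → s≤s⁻¹ (toℕ<n (finToFun c i))) , q)
       (λ (f , f≤b , q) → funToFin (code f f≤b) , respects (sym ∘ decode-code f f≤b) q)
       (any? (Q? ∘ decode))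
  where
  decode : Fin (suc b ^ m) → Fin m → ℕ
  decode c = toℕ ∘ finToFun c
  code : (f : Fin m → ℕ) → (∀ i → f i ≤ b) → Fin m → Fin (suc b)
  code f f≤b i = fromℕ< (s≤s (f≤b i))
  decode-code : ∀ f f≤b → decode (funToFin (code f f≤b)) ≗ f
  decode-code f f≤b i = trans (cong toℕ (finToFun-funToFin (code f f≤b) i)) (toℕ-fromℕ< _)

cost-tabulate : ∀ G f → cost G f ≡ sum (tabulate f)
cost-tabulate G f = cong sum (map-tabulate id f)

entry≤sum : ∀ {m} (h : Fin m → ℕ) i → h i ≤ sum (tabulate h)
entry≤sum h zero    = m≤m+n _ _
entry≤sum h (suc i) = ≤-trans (entry≤sum (h ∘ suc) i) (m≤n+m _ _)

entry≤cost : ∀ G f i → f i ≤ cost G f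
entry≤cost G f i = subst (f i ≤_) (sym (cost-tabulate G f)) (entry≤sum f i)

cost-cong : ∀ G {f g} → f ≗ g → cost G f ≡ cost G g
cost-cong G f≗g = cong sum (map-cong f≗g (allFin (n G)))

resolving-cong : ∀ G {f g} → f ≗ g → IsResolvingBroadcast G f → IsResolvingBroadcast G g
resolving-cong G f≗g res x y x≢y with res x y x≢y
... | z , positive , separates rewrite f≗g z = z , positive , separates

-- Every graph has a broadcast dimension: strength 1 everywhere resolves, and
-- broadcasts of cost ≤ b take values ≤ b, so bounded search decides cost ≤ b.
bdim-exists : (G : Graph) → Σ ℕ (IsBdim G)
bdim-exists G =
  minimum-exists (IsResolvingBroadcast G) (cost G) cheap?
    ((λ _ → 1) , λ x y x≢y → x , s≤s z≤n , separates-self x≢y)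
  where
  cheap? : ∀ b → Dec (Σ (Fin (n G) → ℕ) λ f → IsResolvingBroadcast G f × cost G f ≤ b)
  cheap? b =
    map′ (λ (f , _ , q) → f , q)
         (λ (f , q) → f , (λ i → ≤-trans (entry≤cost G f i) (proj₂ q)) , q)
         (bounded-search b _
            (λ f≗g (res , c≤b) → resolving-cong G f≗g res , subst (_≤ b) (cost-cong G f≗g) c≤b)
            (λ f → Decision.resolving? G f ×-dec (cost G f ≤? b)))

∣p++q∣ : ∀ {m r} (p : Subset m) (q : Subset r) → ∣ p ++ q ∣ ≡ ∣ p ∣ + ∣ q ∣
∣p++q∣ []          q = refl
∣p++q∣ (true ∷ p)  q = cong suc (∣p++q∣ p q)
∣p++q∣ (false ∷ p) q = ∣p++q∣ p q

∣p∪q∣≤∣p∣+∣q∣ : ∀ {m} (p q : Subset m) → ∣ p ∪ q ∣ ≤ ∣ p ∣ + ∣ q ∣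
∣p∪q∣≤∣p∣+∣q∣ []          []         = z≤n
∣p∪q∣≤∣p∣+∣q∣ (true ∷ p)  (b ∷ q)    =
  s≤s (≤-trans (∣p∪q∣≤∣p∣+∣q∣ p q) (+-monoʳ-≤ ∣ p ∣ (∣p∣≤∣x∷p∣ b q)))
∣p∪q∣≤∣p∣+∣q∣ (false ∷ p) (true ∷ q)  =
  subst (suc ∣ p ∪ q ∣ ≤_) (sym (+-suc ∣ p ∣ ∣ q ∣)) (s≤s (∣p∪q∣≤∣p∣+∣q∣ p q))
∣p∪q∣≤∣p∣+∣q∣ (false ∷ p) (false ∷ q) = ∣p∪q∣≤∣p∣+∣q∣ p q

misses-one : ∀ {m} (p : Subset m) → (∀ j j′ → j ≢ j′ → j ∈ p ⊎ j′ ∈ p) → m ≤ suc ∣ p ∣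
misses-one []          _    = z≤n
misses-one (true ∷ p)  pair =
  s≤s (misses-one p λ j j′ j≢j′ →
         Sum.map drop-there drop-there (pair (suc j) (suc j′) (j≢j′ ∘ suc-injective)))
misses-one {suc m} (false ∷ p) pair =
  s≤s (subst (_≤ ∣ p ∣) (∣⊤∣≡n m) (p⊆q⇒∣p∣≤∣q∣ {p = ⊤} λ {j} _ → everything-in j))
  where
  everything-in : ∀ j → j ∈ p
  everything-in j = [ drop-there , (λ ()) ]′ (pair (suc j) zero (λ ()))

∈-++ˡ⁻ : ∀ {m r} {p : Subset m} {q : Subset r} x → (x ↑ˡ r) ∈ (p ++ q) → x ∈ p
∈-++ˡ⁻ {p = _ ∷ _} zero    here       = here
∈-++ˡ⁻ {p = _ ∷ _} (suc x) (there x∈) = there (∈-++ˡ⁻ x x∈)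

∈-++ʳ⁻ : ∀ {m r} (p : Subset m) {q : Subset r} {x} → (m ↑ʳ x) ∈ (p ++ q) → x ∈ q
∈-++ʳ⁻ []      x∈ = x∈
∈-++ʳ⁻ (_ ∷ p) x∈ = ∈-++ʳ⁻ p (drop-there x∈)

sum-tabulate-+ : ∀ m {r} (h : Fin (m + r) → ℕ) →
                 sum (tabulate h) ≡ sum (tabulate (h ∘ (_↑ˡ r))) + sum (tabulate (h ∘ (m ↑ʳ_)))
sum-tabulate-+ zero    h = refl
sum-tabulate-+ (suc m) h =
  trans (cong (h zero +_) (sum-tabulate-+ m (h ∘ suc))) (sym (+-assoc (h zero) _ _))

sum-tabulate-const : ∀ m {c} (h : Fin m → ℕ) → (∀ i → h i ≡ c) → sum (tabulate h) ≡ m * c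
sum-tabulate-const zero    h _     = refl
sum-tabulate-const (suc m) h const =
  cong₂ _+_ (const zero) (sum-tabulate-const m (h ∘ suc) (const ∘ suc))

-- Binary digits (Data.Fin's finToFun) tell numbers below 2^k apart; this
-- needs that the inverse funToFin respects pointwise equality.
funToFin-cong : ∀ {m r} {f g : Fin m → Fin r} → f ≗ g → funToFin f ≡ funToFin g
funToFin-cong {zero}  _    = refl
funToFin-cong {suc m} f≗g = cong₂ combine (f≗g zero) (funToFin-cong (f≗g ∘ suc))

digits-differ : ∀ {k} {j j′ : Fin (2 ^ k)} → j ≢ j′ →
                Σ (Fin k) λ i → finToFun j i ≢ finToFun j′ i
digits-differ {k} {j} {j′} j≢j′ =
  ¬∀⟶∃¬ k _ (λ i → finToFun j i ≟ finToFun j′ i) λ same →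
    j≢j′ (trans (sym (funToFin-finToFin {k} {2} j))
                (trans (funToFin-cong same) (funToFin-finToFin {k} {2} j′)))

isOne : Fin 2 → Bool
isOne zero       = false
isOne (suc zero) = true

isOne-injective : ∀ {d d′} → isOne d ≡ isOne d′ → d ≡ d′
isOne-injective {zero}     {zero}     _ = refl
isOne-injective {zero}     {suc zero} ()
isOne-injective {suc zero} {zero}     ()
isOne-injective {suc zero} {suc zero} _ = refl

if-injective : ∀ {x y : ℕ} {s t} → x ≢ y → s ≢ t →
               (if s then x else y) ≢ (if t then x else y)
if-injective {s = true}  {true}  _   s≢t = ⊥-elim (s≢t refl)
if-injective {s = true}  {false} x≢y _   = x≢y
if-injective {s = false} {true}  x≢y _   = x≢y ∘ sym
if-injective {s = false} {false} _   s≢t = ⊥-elim (s≢t refl)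

module Example (k : ℕ) where

  -- Number of hubs (= leaves), of landmarks, and of vertices.
  P : ℕ
  P = 2 ^ k
  K : ℕ
  K = suc k
  N : ℕ
  N = K + (P + P)

  data Vertex : Set where
    land : Fin K → Vertex
    hub  : Fin P → Vertex
    leaf : Fin P → Vertex

  row : Fin P → Fin K → Bool
  row j zero    = true
  row j (suc i) = isOne (finToFun j i)

  edge : Vertex → Vertex → Bool
  edge (land i) (hub j)  = row j i
  edge (hub j)  (land i) = row j i
  edge (hub j)  (leaf j′) = does (j ≟ j′)
  edge (leaf j) (hub j′)  = does (j′ ≟ j)
  edge _        _         = false

  edge-sym : ∀ v w → edge v w ≡ edge w v
  edge-sym (land _) (land _) = refl
  edge-sym (land _) (hub _)  = refl
  edge-sym (land _) (leaf _) = refl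
  edge-sym (hub _)  (land _) = refl
  edge-sym (hub _)  (hub _)  = refl
  edge-sym (hub _)  (leaf _) = refl
  edge-sym (leaf _) (land _) = refl
  edge-sym (leaf _) (hub _)  = refl
  edge-sym (leaf _) (leaf _) = refl

  edge-irrefl : ∀ v → edge v v ≡ false
  edge-irrefl (land _) = refl
  edge-irrefl (hub _)  = refl
  edge-irrefl (leaf _) = refl

  allOnes : Fin P
  allOnes = funToFin {k} {2} (λ _ → suc zero)

  row-allOnes : ∀ i → row allOnes i ≡ true
  row-allOnes zero    = refl
  row-allOnes (suc i) = cong isOne (finToFun-funToFin {k} {2} (λ _ → suc zero) i)

  leaf-hub : ∀ j → edge (leaf j) (hub j) ≡ true
  leaf-hub j = dec-true (j ≟ j) refl

  leaf-neighbour : ∀ j v → edge (leaf j) v ≡ true → v ≡ hub j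
  leaf-neighbour j (hub j′) e with j′ ≟ j
  ... | yes j′≡j = cong hub j′≡j
  leaf-neighbour j (hub j′) () | no _

  view : Fin N → Vertex
  view x = [ land , [ leaf , hub ]′ ∘ splitAt P ]′ (splitAt K x)

  enc : Vertex → Fin N
  enc (land i) = i ↑ˡ (P + P)
  enc (leaf j) = K ↑ʳ (j ↑ˡ P)
  enc (hub j)  = K ↑ʳ (P ↑ʳ j)

  view-enc : ∀ v → view (enc v) ≡ v
  view-enc (land i) rewrite splitAt-↑ˡ K i (P + P) = refl
  view-enc (leaf j) rewrite splitAt-↑ʳ K (P + P) (j ↑ˡ P) | splitAt-↑ˡ P j P = refl
  view-enc (hub j)  rewrite splitAt-↑ʳ K (P + P) (P ↑ʳ j) | splitAt-↑ʳ P P j = refl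

  enc-view : ∀ x → enc (view x) ≡ x
  enc-view x with splitAt K x in e
  ... | inj₁ i = splitAt⁻¹-↑ˡ e
  ... | inj₂ r with splitAt P r in e′
  ...   | inj₁ j = trans (cong (K ↑ʳ_) (splitAt⁻¹-↑ˡ e′)) (splitAt⁻¹-↑ʳ e)
  ...   | inj₂ j = trans (cong (K ↑ʳ_) (splitAt⁻¹-↑ʳ e′)) (splitAt⁻¹-↑ʳ e)

  enc-injective : ∀ {v w} → enc v ≡ enc w → v ≡ w
  enc-injective {v} {w} eq = trans (sym (view-enc v)) (trans (cong view eq) (view-enc w))

  view-injective : ∀ {x y} → view x ≡ view y → x ≡ y
  view-injective {x} {y} eq = trans (sym (enc-view x)) (trans (cong enc eq) (enc-view y))

  H : Graph
  H = record { n = N ; adj = λ x y → edge (view x) (view y)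
             ; sym = λ x y → edge-sym (view x) (view y) ; irrefl = edge-irrefl ∘ view }

  adj-enc : ∀ v x → adj H (enc v) x ≡ edge v (view x)
  adj-enc v x = cong (λ u → edge u (view x)) (view-enc v)

  adj-enc² : ∀ v w → adj H (enc v) (enc w) ≡ edge v w
  adj-enc² v w = trans (adj-enc v (enc w)) (cong (edge v) (view-enc w))

  adj-enc′ : ∀ x w → adj H x (enc w) ≡ edge (view x) w
  adj-enc′ x w = cong (edge (view x)) (view-enc w)

  d₂-adjacent : ∀ v w → v ≢ w → edge v w ≡ true → TDist H 2 (enc v) (enc w) 1
  d₂-adjacent v w v≢w e = tdist-adjacent (v≢w ∘ enc-injective) (trans (adj-enc² v w) e)

  d₂-common : ∀ v c w → v ≢ w → edge v w ≢ true → edge v c ≡ true → edge c w ≡ true →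
              TDist H 2 (enc v) (enc w) 2
  d₂-common v c w v≢w ¬e e e′ =
    tdist-common {w = enc c} (v≢w ∘ enc-injective) (¬e ∘ trans (sym (adj-enc² v w)))
      (trans (adj-enc² v c) e) (trans (adj-enc² c w) e′)

  d₂-far : ∀ v w → v ≢ w → edge v w ≢ true →
           (∀ c → edge v c ≡ true → edge c w ≢ true) → TDist H 2 (enc v) (enc w) 3
  d₂-far v w v≢w ¬e no-common =
    tdist-beyond₂ (v≢w ∘ enc-injective) (¬e ∘ trans (sym (adj-enc² v w)))
      λ x a a′ → no-common (view x) (trans (sym (adj-enc v x)) a) (trans (sym (adj-enc′ x w)) a′)

  -- profile v i = d₂(v, z_i).
  profile : Vertex → Fin K → ℕ
  profile (land i′) i = if does (i′ ≟ i) then 0 else 2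
  profile (hub j)   i = if row j i then 1 else 3
  profile (leaf j)  i = if row j i then 2 else 3

  -- Landmarks meet through the all-ones hub; a hub is adjacent to z_i or at
  -- distance 3; a leaf reaches z_i through its hub or not within distance 2.
  profile-correct : ∀ v i → TDist H 2 (enc v) (enc (land i)) (profile v i)
  profile-correct (land i′) i with i′ ≟ i
  ... | yes refl = tdist-self
  ... | no i′≢i  = d₂-common (land i′) (hub allOnes) (land i) (λ { refl → i′≢i refl }) (λ ())
                     (row-allOnes i′) (row-allOnes i)
  profile-correct (hub j) i with row j i in e
  ... | true  = d₂-adjacent (hub j) (land i) (λ ()) e
  ... | false = d₂-far (hub j) (land i) (λ ()) (not-¬ e)
                  λ { (land _) _ () ; (hub _) () ; (leaf _) _ () }
  profile-correct (leaf j) i with row j i in e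
  ... | true  = d₂-common (leaf j) (hub j) (land i) (λ ()) (λ ()) (leaf-hub j) e
  ... | false = d₂-far (leaf j) (land i) (λ ()) (λ ()) λ c a →
                  subst (λ u → edge u (land i) ≢ true) (sym (leaf-neighbour j c a)) (not-¬ e)

  profile-zero : ∀ v i → profile v i ≡ 0 → v ≡ land i
  profile-zero (land i′) i with i′ ≟ i
  ... | yes refl = λ _ → refl
  ... | no _     = λ ()
  profile-zero (hub j) i with row j i
  ... | true  = λ ()
  ... | false = λ ()
  profile-zero (leaf j) i with row j i
  ... | true  = λ ()
  ... | false = λ ()

  landmark-separates : ∀ i w → land i ≢ w → profile (land i) i ≢ profile w i
  landmark-separates i w i≢w eq =
    i≢w (sym (profile-zero w i (trans (sym eq) self-zero)))
    where
    self-zero : profile (land i) i ≡ 0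
    self-zero = cong (λ b → if b then 0 else 2) (dec-true (i ≟ i) refl)

  -- Distinct vertices have distinct profiles: z₀ tells hubs from leaves,
  -- a differing digit tells two hubs (or two leaves) apart.
  profiles-separate : ∀ v w → v ≢ w → Σ (Fin K) λ i → profile v i ≢ profile w i
  profiles-separate (land i) w v≢w = i , landmark-separates i w v≢w
  profiles-separate v (land i) v≢w = i , landmark-separates i v (v≢w ∘ sym) ∘ sym
  profiles-separate (hub j) (hub j′) v≢w with digits-differ {k} (v≢w ∘ cong hub)
  ... | i , differ = suc i , if-injective (λ ()) (differ ∘ isOne-injective)
  profiles-separate (leaf j) (leaf j′) v≢w with digits-differ {k} (v≢w ∘ cong leaf)
  ... | i , differ = suc i , if-injective (λ ()) (differ ∘ isOne-injective)
  profiles-separate (hub _)  (leaf _) _ = zero , λ ()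
  profiles-separate (leaf _) (hub _)  _ = zero , λ ()

  budget : Fin N → ℕ
  budget x = [ (λ _ → 2) , (λ _ → 0) ]′ (splitAt K x)

  budget-land : ∀ i → budget (enc (land i)) ≡ 2
  budget-land i rewrite splitAt-↑ˡ K i (P + P) = refl

  budget-rest : ∀ r → budget (K ↑ʳ r) ≡ 0
  budget-rest r rewrite splitAt-↑ʳ K (P + P) r = refl

  budget-resolves : IsResolvingBroadcast H budget
  budget-resolves x y x≢y with profiles-separate (view x) (view y) (x≢y ∘ view-injective)
  ... | i , differ = enc (land i) ,
    subst (λ s → 0 < s × Separates H s (enc (land i)) x y) (sym (budget-land i))
      (s≤s z≤n , _ , _ , d₂-to-landmark x , d₂-to-landmark y , differ)
    where
    d₂-to-landmark : ∀ x → TDist H 2 x (enc (land i)) (profile (view x) i)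
    d₂-to-landmark x =
      subst (λ u → TDist H 2 u (enc (land i)) (profile (view x) i)) (enc-view x)
        (profile-correct (view x) i)

  cost-budget : cost H budget ≡ K * 2
  cost-budget = begin
    cost H budget
      ≡⟨ cost-tabulate H budget ⟩
    sum (tabulate budget)
      ≡⟨ sum-tabulate-+ K {P + P} budget ⟩
    sum (tabulate (budget ∘ enc ∘ land)) + sum (tabulate (budget ∘ (K ↑ʳ_)))
      ≡⟨ cong₂ _+_ (sum-tabulate-const K (budget ∘ enc ∘ land) budget-land)
                   (sum-tabulate-const (P + P) (budget ∘ (K ↑ʳ_)) budget-rest) ⟩
    K * 2 + (P + P) * 0
      ≡⟨ cong (K * 2 +_) (*-zeroʳ (P + P)) ⟩
    K * 2 + 0
      ≡⟨ +-identityʳ (K * 2) ⟩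
    K * 2
      ∎
    where open ≡-Reasoning

  bdim-bound : ∀ {b} → IsBdim H b → b ≤ K * 2
  bdim-bound (_ , optimal) = ≤-trans (optimal budget budget-resolves) (≤-reflexive cost-budget)

  far-from-leaf : ∀ j x → view x ≢ leaf j → view x ≢ hub j → TDist H 1 (enc (leaf j)) x 2
  far-from-leaf j x not-leaf not-hub =
    tdist-beyond₁ (λ eq → not-leaf (trans (cong view (sym eq)) (view-enc (leaf j))))
                  (λ a → not-hub (leaf-neighbour j (view x) (trans (sym (adj-enc (leaf j) x)) a)))

  Covered : Subset N → Fin P → Set
  Covered A j = enc (leaf j) ∈ A ⊎ enc (hub j) ∈ A

  covered : ∀ {A z j} → z ∈ A → view z ≡ leaf j ⊎ view z ≡ hub j → Covered A j
  covered {A} {z} z∈A = Sum.map member member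
    where
    member : ∀ {v} → view z ≡ v → enc v ∈ A
    member eq = subst (_∈ A) (trans (sym (enc-view z)) (cong enc eq)) z∈A

  leaf-injective : ∀ {j j′} → leaf j ≡ leaf j′ → j ≡ j′
  leaf-injective refl = refl

  in-pair? : ∀ j v → Dec (v ≡ leaf j ⊎ v ≡ hub j)
  in-pair? j (land _)  = no λ { (inj₁ ()) ; (inj₂ ()) }
  in-pair? j (leaf j′) with j′ ≟ j
  ... | yes refl = yes (inj₁ refl)
  ... | no j′≢j  = no λ { (inj₁ refl) → j′≢j refl ; (inj₂ ()) }
  in-pair? j (hub j′)  with j′ ≟ j
  ... | yes refl = yes (inj₂ refl)
  ... | no j′≢j  = no λ { (inj₁ ()) ; (inj₂ refl) → j′≢j refl }

  -- Of any two distinct pairs, an adjacency resolving set covers one: the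
  -- vertex separating their leaves must lie in one of the pairs.
  covers-one-of : ∀ A → IsAdjResolving H A → ∀ j j′ → j ≢ j′ → Covered A j ⊎ Covered A j′
  covers-one-of A res j j′ j≢j′
    with res (enc (leaf j)) (enc (leaf j′)) (j≢j′ ∘ leaf-injective ∘ enc-injective)
  ... | z , z∈A , separates with in-pair? j (view z) | in-pair? j′ (view z)
  ...   | yes in-j | _        = inj₁ (covered z∈A in-j)
  ...   | no _     | yes in-j′ = inj₂ (covered z∈A in-j′)
  ...   | no out   | no out′   = ⊥-elim (not-separating
            (far-from-leaf j z (out ∘ inj₁) (out ∘ inj₂))
            (far-from-leaf j′ z (out′ ∘ inj₁) (out′ ∘ inj₂)) separates)

  adj-resolving-size : ∀ A → IsAdjResolving H A → P ≤ suc ∣ A ∣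
  adj-resolving-size A res with Vec.splitAt K A
  ... | A-land , A-pairs , refl with Vec.splitAt P A-pairs
  ...   | A-leaf , A-hub , refl = begin
    P                                      ≤⟨ misses-one (A-leaf ∪ A-hub) covering ⟩
    suc ∣ A-leaf ∪ A-hub ∣                 ≤⟨ s≤s (∣p∪q∣≤∣p∣+∣q∣ A-leaf A-hub) ⟩
    suc (∣ A-leaf ∣ + ∣ A-hub ∣)            ≤⟨ s≤s (m≤n+m _ ∣ A-land ∣) ⟩
    suc (∣ A-land ∣ + (∣ A-leaf ∣ + ∣ A-hub ∣)) ≡⟨ cong suc (sym size) ⟩
    suc ∣ A-land ++ (A-leaf ++ A-hub) ∣     ∎
    where
    open ≤-Reasoning
    size : ∣ A-land ++ (A-leaf ++ A-hub) ∣ ≡ ∣ A-land ∣ + (∣ A-leaf ∣ + ∣ A-hub ∣)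
    size = trans (∣p++q∣ A-land _) (cong (∣ A-land ∣ +_) (∣p++q∣ A-leaf A-hub))
    pair-members : ∀ {j} → Covered (A-land ++ (A-leaf ++ A-hub)) j → j ∈ A-leaf ∪ A-hub
    pair-members {j} =
      x∈p∪q⁺ ∘ Sum.map (∈-++ˡ⁻ j ∘ ∈-++ʳ⁻ A-land) (∈-++ʳ⁻ A-leaf ∘ ∈-++ʳ⁻ A-land)
    covering : ∀ j j′ → j ≢ j′ → j ∈ A-leaf ∪ A-hub ⊎ j′ ∈ A-leaf ∪ A-hub
    covering j j′ j≢j′ = Sum.map pair-members pair-members (covers-one-of _ res j j′ j≢j′)

  adim-bound : ∀ {a} → IsAdim H a → P ≤ suc a
  adim-bound ((A , res , refl) , _) = adj-resolving-size A res

n<2^n : ∀ n → n < 2 ^ n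
n<2^n zero    = s≤s z≤n
n<2^n (suc n) = +-mono-≤ (m^n>0 2 n) (≤-trans (n<2^n n) (m≤m+n _ 0))

halve : ∀ j a → 2 ^ suc j ≤ suc a → 2 ^ j ≤ a
halve j a le = s≤s⁻¹ (begin
  suc (2 ^ j)  ≡⟨ +-comm 1 (2 ^ j) ⟩
  2 ^ j + 1    ≤⟨ +-monoʳ-≤ (2 ^ j) (≤-trans (m^n>0 2 j) (m≤m+n _ 0)) ⟩
  2 ^ suc j    ≤⟨ le ⟩
  suc a        ∎)
  where open ≤-Reasoning

log-bound : ∀ {j a} → 2 ^ j ≤ a → j ≤ ⌊log₂ a ⌋
log-bound {j} le = subst (_≤ _) (⌊log₂[2^n]⌋≡n j) (⌊log₂⌋-mono-≤ le)

cost-vs-log : ∀ m → (3 + m) * 2 ≤ suc m * 6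
cost-vs-log zero    = ≤-refl
cost-vs-log (suc m) = +-mono-≤ {2} {6} (s≤s (s≤s z≤n)) (cost-vs-log m)

theorem1p5 : Σ ℕ λ C → (m : ℕ) → Σ Graph λ G → Σ ℕ λ a → Σ ℕ λ b →
    IsAdim G a × IsBdim G b × m ≤ a × b ≤ C * ⌊log₂ a ⌋
theorem1p5 = 6 , optimal
  where
  optimal : (m : ℕ) → Σ Graph λ G → Σ ℕ λ a → Σ ℕ λ b →
            IsAdim G a × IsBdim G b × m ≤ a × b ≤ 6 * ⌊log₂ a ⌋
  optimal m = H , a , b , adim , bdim , m≤a , b≤6log
    where
    open Example (2 + m) using (H; adim-bound; bdim-bound)
    a : ℕ
    a = proj₁ (adim-exists H)
    adim : IsAdim H a
    adim = proj₂ (adim-exists H)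
    b : ℕ
    b = proj₁ (bdim-exists H)
    bdim : IsBdim H b
    bdim = proj₂ (bdim-exists H)
    large : 2 ^ suc m ≤ a
    large = halve (suc m) a (adim-bound adim)
    m≤a : m ≤ a
    m≤a = ≤-trans (≤-trans (n≤1+n m) (<⇒≤ (n<2^n (suc m)))) large
    b≤6log : b ≤ 6 * ⌊log₂ a ⌋
    b≤6log = begin
      b               ≤⟨ bdim-bound bdim ⟩
      (3 + m) * 2     ≤⟨ cost-vs-log m ⟩
      suc m * 6       ≡⟨ *-comm (suc m) 6 ⟩
      6 * suc m       ≤⟨ *-monoʳ-≤ 6 (log-bound large) ⟩
      6 * ⌊log₂ a ⌋   ∎
      where open ≤-Reasoning
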